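{- Let the hierarchy be one-dimensional, let $S$ be a finite multiset of fully specified elements, and let $P$ be any set of prefixes. For a prefix $p$ put $P_p=\{q\in P: q\prec p\}$ and $$H_p=\{h\in P:\ h\prec p \text{ and there is no } h'\in P \text{ with } h\prec h'\prec p\}.$$ Let the conditioned count of $p$ with respect to $P$ be $F_p=\sum_{e\in S,\ e\preceq p,\ e\not\preceq P_p} f(e)$, where $e\not\preceq P_p$ means there is no $q\in P_p$ with $e\preceq q$. Then $$F_p = f(p)-\sum_{h\in H_p} f(h).$$
   Context: One-dimensional hierarchy: a finite rooted hierarchy of depth $h$. Its elements (prefixes) have depths $0,\dots,h$, the root (fully general element) has depth $0$, and every non-root element $p$ of depth $k$ has a unique parent $\mathrm{par}(p)$ of depth $k-1$. Elements of depth $h$ are called fully specified. Example: IPv4 addresses at byte granularity, with $h=4$, where $021.132.145.*$ is the parent of $021.132.145.146$. Write $p\preceq q$ if $q$ equals $p$ or is an ancestor of $p$, and $p\prec q$ if $p\preceq q$ and $p\neq q$. For the multiset $S$ (elements counted with multiplicity), $f(e)$ is the multiplicity (frequency) of a fully specified $e$ in $S$. The unconditioned count of a prefix $p$ is $f(p)=\sum_{e\in S,\ e\preceq p} f(e)$. -}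

module Defs where

open import Data.List using (List; []; _∷_; length; filter)
open import Data.List.Properties using (≡-dec)
open import Data.List.Relation.Unary.Any using (Any; any?)
open import Data.Product using (_×_; ∃; _,_)
open import Data.Product.Properties using ()
open import Data.Nat using (ℕ)
open import Data.Empty using (⊥-elim)
open import Relation.Nullary using (¬_; Dec; yes; no; ¬?)
open import Relation.Nullary.Decidable using (_×-dec_)
open import Relation.Binary.PropositionalEquality using (_≡_; refl)
open import Relation.Binary.Definitions using (DecidableEquality)

-- A one-dimensional hierarchy, modelled by paths from the root:
-- a prefix of depth k is a list of k labels, the HEAD being the deepest
-- label.
-- Every finite rooted hierarchy embeds into this one (label each node
-- by itself), preserving depth, parent and ancestry.
module Hierarchy {A : Set} (_≟A_ : DecidableEquality A) where

  Prefix : Set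
  Prefix = List A

  depth : Prefix → ℕ
  depth = length

  _≟_ : DecidableEquality Prefix
  _≟_ = ≡-dec _≟A_

  data _⪯_ : Prefix → Prefix → Set where
    here  : ∀ {p} → p ⪯ p
    there : ∀ {a p q} → p ⪯ q → (a ∷ p) ⪯ q

  _≺_ : Prefix → Prefix → Set
  p ≺ q = p ⪯ q × ¬ (p ≡ q)

  _⪯?_ : (p q : Prefix) → Dec (p ⪯ q)
  p ⪯? q with p ≟ q
  ... | yes refl = yes here
  [] ⪯? q | no p≢q = no λ { here → p≢q refl }
  (a ∷ p) ⪯? q | no p≢q with p ⪯? q
  ... | yes r = yes (there r)
  ... | no ¬r = no λ { here → p≢q refl ; (there r) → ¬r r }

  _≺?_ : (p q : Prefix) → Dec (p ≺ q)
  p ≺? q = (p ⪯? q) ×-dec ¬? (p ≟ q)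

  -- Unconditioned count f(p) = Σ_{e ∈ S, e ⪯ p} f(e): the number of
  -- occurrences (with multiplicity) in the multiset S (a list) of
  -- elements below p.
  count : List Prefix → Prefix → ℕ
  count S p = length (filter (λ e → e ⪯? p) S)

  NotBelowPp : List Prefix → Prefix → Prefix → Set
  NotBelowPp P p e = ¬ Any (λ q → q ≺ p × e ⪯ q) P

  notBelowPp? : (P : List Prefix) (p e : Prefix) → Dec (NotBelowPp P p e)
  notBelowPp? P p e = ¬? (any? (λ q → (q ≺? p) ×-dec (e ⪯? q)) P)

  condCount : List Prefix → List Prefix → Prefix → ℕ
  condCount S P p =
    length (filter (λ e → (e ⪯? p) ×-dec notBelowPp? P p e) S)

  InH : List Prefix → Prefix → Prefix → Set
  InH P p h = h ≺ p × ¬ Any (λ h' → h ≺ h' × h' ≺ p) P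

  inH? : (P : List Prefix) (p h : Prefix) → Dec (InH P p h)
  inH? P p h = (h ≺? p) ×-dec ¬? (any? (λ h' → (h ≺? h') ×-dec (h' ≺? p)) P)

  -- The list of elements of H_p (P is a duplicate-free list).
  Hset : List Prefix → Prefix → List Prefix
  Hset P p = filter (inH? P p) P

-- Count each e ∈ S on both sides.  If e ⋠ p it is counted nowhere, and if
-- e ⪯ p but e ⋠ P_p it lies below no h ∈ H_p.  Otherwise e lies below some
-- q ∈ P_p; climbing from q towards p through members of P (depth strictly
-- decreases) reaches a member of H_p above e, and it is the only one: the
-- ancestors of e form a chain, so two distinct members of H_p above e would
-- be comparable, contradicting the minimality built into H_p.  Hence e
-- contributes 1 to f(p) and exactly 1 to either F_p or Σ_{h ∈ H_p} f(h).
module Submission where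

open import Level using (Level)
open import Data.Bool using (if_then_else_; true; false)
open import Data.Empty using (⊥-elim)
open import Data.Integer using (+_; _-_; _⊖_)
open import Data.Integer.Properties using ([+m]-[+n]≡m⊖n; ⊖-≥)
open import Data.List using (List; []; _∷_; length; map; filter)
open import Data.List.Membership.Propositional using (_∈_; find; lose)
open import Data.List.Membership.Propositional.Properties using (∈-filter⁺; ∈-filter⁻)
open import Data.List.Properties using (filter-none)
open import Data.List.Relation.Unary.All as All using (All)
open import Data.List.Relation.Unary.Any using (here; there; any?)
open import Data.List.Relation.Unary.Unique.Propositional using (Unique; _∷_)
open import Data.List.Relation.Unary.Unique.Propositional.Properties using (filter⁺)
open import Data.Nat using (ℕ; suc; _+_; _∸_; _≤_; _<_; s≤s)
open import Data.Nat.Induction using (<-wellFounded)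
open import Data.Nat.ListAction using (sum)
open import Data.Nat.Properties using (≤-refl; ≤-trans; n≤1+n; m≤n+m; m+n∸n≡m; +-commutativeSemigroup)
open import Algebra.Properties.CommutativeSemigroup +-commutativeSemigroup using (interchange)
open import Data.Product using (_×_; _,_; proj₁; ∃-syntax)
open import Data.Sum using (_⊎_; inj₁; inj₂)
open import Induction.WellFounded using (Acc; acc)
open import Relation.Nullary using (¬_; Dec; yes; no; does)
open import Relation.Nullary.Decidable using (_×-dec_; decidable-stable)
open import Relation.Unary using (Pred; Decidable)
open import Relation.Binary.PropositionalEquality using (_≡_; refl; sym; trans; cong; cong₂; module ≡-Reasoning)
open import Relation.Binary.Definitions using (DecidableEquality)

open import Defs

indicator : ∀ {ℓ} {P : Set ℓ} → Dec P → ℕ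
indicator P? = if does P? then 1 else 0

module _ {a ℓ : Level} {B : Set a} {Q : Pred B ℓ} (Q? : Decidable Q) where

  length-filter-∷ : ∀ {x} xs →
    length (filter Q? (x ∷ xs)) ≡ indicator (Q? x) + length (filter Q? xs)
  length-filter-∷ {x} xs with does (Q? x)
  ... | true  = refl
  ... | false = refl

  length-filter≡0 : ∀ {xs} → (∀ {y} → y ∈ xs → ¬ Q y) → length (filter Q? xs) ≡ 0
  length-filter≡0 ¬Q = cong length (filter-none Q? (All.tabulate ¬Q))

  length-filter≡1 : ∀ {xs x} → Unique xs → x ∈ xs → Q x →
    (∀ {y} → y ∈ xs → Q y → y ≡ x) → length (filter Q? xs) ≡ 1
  length-filter≡1 {y ∷ ys} (y∉ys ∷ uniq) x∈ Qx only with Q? y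
  ... | yes Qy = cong suc (length-filter≡0 λ z∈ Qz →
                   All.lookup y∉ys z∈ (trans (only (here refl) Qy) (sym (only (there z∈) Qz))))
  ... | no ¬Qy with x∈
  ...   | here refl = ⊥-elim (¬Qy Qx)
  ...   | there x∈ys = length-filter≡1 uniq x∈ys Qx (λ z∈ Qz → only (there z∈) Qz)

module _ {A : Set} (_≟A_ : DecidableEquality A) where
  open Hierarchy _≟A_

  ⪯-trans : ∀ {p q r} → p ⪯ q → q ⪯ r → p ⪯ r
  ⪯-trans here        q⪯r = q⪯r
  ⪯-trans (there p⪯q) q⪯r = there (⪯-trans p⪯q q⪯r)

  ⪯⇒depth≥ : ∀ {p q} → p ⪯ q → depth q ≤ depth p
  ⪯⇒depth≥ here        = ≤-refl
  ⪯⇒depth≥ (there p⪯q) = ≤-trans (⪯⇒depth≥ p⪯q) (n≤1+n _)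

  ≺⇒depth> : ∀ {p q} → p ≺ q → depth q < depth p
  ≺⇒depth> (here      , p≢p) = ⊥-elim (p≢p refl)
  ≺⇒depth> (there p⪯q , _)   = s≤s (⪯⇒depth≥ p⪯q)

  ⪯-total-above : ∀ {e p q} → e ⪯ p → e ⪯ q → p ⪯ q ⊎ q ⪯ p
  ⪯-total-above here        e⪯q         = inj₁ e⪯q
  ⪯-total-above (there e⪯p) here        = inj₂ (there e⪯p)
  ⪯-total-above (there e⪯p) (there e⪯q) = ⪯-total-above e⪯p e⪯q

  sum-map-count-[] : ∀ H → sum (map (count []) H) ≡ 0
  sum-map-count-[] []      = refl
  sum-map-count-[] (_ ∷ H) = sum-map-count-[] H

  sum-map-count-∷ : ∀ e S H →
    sum (map (count (e ∷ S)) H) ≡ length (filter (e ⪯?_) H) + sum (map (count S) H)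
  sum-map-count-∷ e S []      = refl
  sum-map-count-∷ e S (h ∷ H) = begin
    count (e ∷ S) h + sum (map (count (e ∷ S)) H)
      ≡⟨ cong₂ _+_ (length-filter-∷ (_⪯? h) {e} S) (sum-map-count-∷ e S H) ⟩
    (indicator (e ⪯? h) + count S h) + (length (filter (e ⪯?_) H) + sum (map (count S) H))
      ≡⟨ interchange (indicator (e ⪯? h)) (count S h) _ _ ⟩
    (indicator (e ⪯? h) + length (filter (e ⪯?_) H)) + (count S h + sum (map (count S) H))
      ≡⟨ cong (_+ _) (sym (length-filter-∷ (e ⪯?_) H)) ⟩
    length (filter (e ⪯?_) (h ∷ H)) + sum (map (count S) (h ∷ H)) ∎
    where open ≡-Reasoning

  module _ (P : List Prefix) (p : Prefix) where

    counted? : (e : Prefix) → Dec (e ⪯ p × NotBelowPp P p e)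
    counted? e = (e ⪯? p) ×-dec notBelowPp? P p e

    ¬⪯⇒NotBelowPp : ∀ {e} → ¬ e ⪯ p → NotBelowPp P p e
    ¬⪯⇒NotBelowPp e⋠p below = let _ , _ , (q≺p , e⪯q) = find below in e⋠p (⪯-trans e⪯q (proj₁ q≺p))

    ∃-InH-above : ∀ {e q} → Acc _<_ (depth q) → q ∈ P → q ≺ p → e ⪯ q →
                  ∃[ h ] h ∈ P × InH P p h × e ⪯ h
    ∃-InH-above {q = q} (acc rec) q∈P q≺p e⪯q with any? (λ h → (q ≺? h) ×-dec (h ≺? p)) P
    ... | no ¬between = q , q∈P , (q≺p , ¬between) , e⪯q
    ... | yes between =
          let h , h∈P , q≺h , h≺p = find between
          in ∃-InH-above (rec (≺⇒depth> q≺h)) h∈P h≺p (⪯-trans e⪯q (proj₁ q≺h))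

    InH-above-unique : ∀ {e h h′} → h ∈ P → h′ ∈ P → InH P p h → InH P p h′ →
                       e ⪯ h → e ⪯ h′ → h ≡ h′
    InH-above-unique {h = h} {h′} h∈P h′∈P (h≺p , h-minimal) (h′≺p , h′-minimal) e⪯h e⪯h′
      with h ≟ h′
    ... | yes h≡h′ = h≡h′
    ... | no  h≢h′ with ⪯-total-above e⪯h e⪯h′
    ...   | inj₁ h⪯h′ = ⊥-elim (h-minimal (lose h′∈P ((h⪯h′ , h≢h′) , h′≺p)))
    ...   | inj₂ h′⪯h = ⊥-elim (h′-minimal (lose h∈P ((h′⪯h , λ h′≡h → h≢h′ (sym h′≡h)) , h≺p)))

    Hset-above≡0 : ∀ {e} → NotBelowPp P p e → length (filter (e ⪯?_) (Hset P p)) ≡ 0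
    Hset-above≡0 not-below = length-filter≡0 _ λ h∈H e⪯h →
      let h∈P , (h≺p , _) = ∈-filter⁻ (inH? P p) {xs = P} h∈H
      in not-below (lose h∈P (h≺p , e⪯h))

    Hset-above≡1 : ∀ {e} → Unique P → ¬ NotBelowPp P p e →
                   length (filter (e ⪯?_) (Hset P p)) ≡ 1
    Hset-above≡1 {e} unique below
      with find (decidable-stable (any? (λ q → (q ≺? p) ×-dec (e ⪯? q)) P) below)
    ... | q , q∈P , q≺p , e⪯q =
          let h , h∈P , h∈H , e⪯h = ∃-InH-above (<-wellFounded (depth q)) q∈P q≺p e⪯q
          in length-filter≡1 _ (filter⁺ (inH? P p) unique) (∈-filter⁺ (inH? P p) h∈P h∈H) e⪯h
               λ h′∈Hset e⪯h′ →
                 let h′∈P , h′∈H = ∈-filter⁻ (inH? P p) {xs = P} h′∈Hset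
                 in InH-above-unique h′∈P h∈P h′∈H h∈H e⪯h′ e⪯h

    indicator-split : ∀ e → Unique P →
      indicator (e ⪯? p) ≡
      indicator (counted? e) + length (filter (e ⪯?_) (Hset P p))
    indicator-split e unique = split (e ⪯? p) (notBelowPp? P p e)
      where
      split : (e⪯?p : Dec (e ⪯ p)) (not-below? : Dec (NotBelowPp P p e)) →
        indicator e⪯?p ≡ indicator (e⪯?p ×-dec not-below?) + length (filter (e ⪯?_) (Hset P p))
      split (yes _)   (yes not-below) = cong suc (sym (Hset-above≡0 not-below))
      split (yes _)   (no  below)     = sym (Hset-above≡1 unique below)
      split (no  e⋠p) _               = sym (Hset-above≡0 (¬⪯⇒NotBelowPp e⋠p))

    count≡condCount+sum-Hset : ∀ S → Unique P →
      count S p ≡ condCount S P p + sum (map (count S) (Hset P p))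
    count≡condCount+sum-Hset [] _ = sym (sum-map-count-[] (Hset P p))
    count≡condCount+sum-Hset (e ∷ S) unique = begin
      count (e ∷ S) p
        ≡⟨ length-filter-∷ (_⪯? p) {e} S ⟩
      indicator (e ⪯? p) + count S p
        ≡⟨ cong₂ _+_ (indicator-split e unique) (count≡condCount+sum-Hset S unique) ⟩
      (indicator (counted? e) + length (filter (e ⪯?_) H)) + (condCount S P p + sum (map (count S) H))
        ≡⟨ interchange (indicator (counted? e)) _ _ _ ⟩
      (indicator (counted? e) + condCount S P p) + (length (filter (e ⪯?_) H) + sum (map (count S) H))
        ≡⟨ cong₂ _+_ (sym (length-filter-∷ counted? {e} S)) (sym (sum-map-count-∷ e S H)) ⟩
      condCount (e ∷ S) P p + sum (map (count (e ∷ S)) H) ∎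
      where
      open ≡-Reasoning
      H = Hset P p

+[m+n]-+n≡+m : ∀ m n → + (m + n) - + n ≡ + m
+[m+n]-+n≡+m m n = begin
  + (m + n) - + n  ≡⟨ [+m]-[+n]≡m⊖n (m + n) n ⟩
  (m + n) ⊖ n      ≡⟨ ⊖-≥ (m≤n+m n m) ⟩
  + (m + n ∸ n)    ≡⟨ cong +_ (m+n∸n≡m m n) ⟩
  + m              ∎
  where open ≡-Reasoning

lemma1 : {A : Set} (_≟A_ : DecidableEquality A) (h : ℕ)
         (S : List (List A)) (P : List (List A)) (p : List A) →
         All (λ e → length e ≡ h) S →
         Unique P → All (λ q → length q ≤ h) P →
         length p ≤ h →
         let open Hierarchy _≟A_ in
         + condCount S P p ≡ + count S p - + sum (map (count S) (Hset P p))
lemma1 _≟A_ h S P p _ unique _ _ = begin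
  + condCount S P p            ≡⟨ +[m+n]-+n≡+m (condCount S P p) s ⟨
  + (condCount S P p + s) - + s
    ≡⟨ cong (λ n → + n - + s) (count≡condCount+sum-Hset _≟A_ P p S unique) ⟨
  + count S p - + s            ∎
  where
  open Hierarchy _≟A_
  open ≡-Reasoning
  s = sum (map (count S) (Hset P p))
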